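{- Let $A$ be a finite alphabet, $\pi$ a probability on $A$ with $0<\pi(\alpha)<1$ for all $\alpha\in A$, $X\in A^m$ a pattern, and $W$ a random text of length $n$ whose letters are independent with law $\pi$. For $u\in Q_X$ and $0\le j\le n-1$, let $p_X(j,u)$ be the probability that the path labeled $\mathrm{pref}(W,j)$ from the initial state $\varepsilon$ in the automaton $\mathcal{A}_X$ ends in state $u$. Then for every $u\in Q_X$ and every $j\ge m$, $p_X(j,u)$ does not depend on $j$, and $$p_X(j,u)=p_X(u):=\pi(u)-\sum_{v\in Q_X,\ \partial v=u}\pi(v).$$
   Context: $Q_X$ is the set of strict prefixes of $X$. $\mathcal{A}_X$ is the deterministic complete automaton with state set $Q_X$, initial state $\varepsilon$, and transition function $\delta_X(u,\alpha)=$ the longest suffix of $u\alpha$ belonging to $Q_X$. $\mathrm{pref}(W,j)$ is the prefix of length $j$ of $W$. For a word $u=u_0\cdots u_{k-1}$, $\pi(u)=\prod_{i}\pi(u_i)$ (so $\pi(\varepsilon)=1$). For $v\in Q_X$, $\partial v$ denotes the longest strict border of $v$ (a word that is both a strict prefix and a strict suffix of $v$), with $\partial\varepsilon=\bot$. -}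

module Defs where

open import Level using (Level)
open import Data.Bool using (Bool; true; false; if_then_else_; _∧_)
open import Data.Nat using (ℕ; zero; suc; _<_; _∸_; _<ᵇ_)
open import Data.Fin using (Fin)
import Data.Fin.Properties as FinP
open import Data.List using (List; []; _∷_; _++_; [_]; length; take; drop; map; foldl; foldr; concatMap; allFin; upTo)
open import Data.List.Properties using (≡-dec)
open import Data.Maybe using (Maybe; just; nothing)
import Data.Maybe.Properties as MaybeP
open import Data.Product using (_×_)
open import Relation.Nullary using (Dec; does)
open import Relation.Binary.PropositionalEquality using (_≡_)
open import Algebra.Bundles using (CommutativeRing)

Word : ℕ → Set
Word k = List (Fin k)

module _ {k : ℕ} where

  _≟w_ : (u v : Word k) → Dec (u ≡ v)
  _≟w_ = ≡-dec FinP._≟_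

  _≟mw_ : (u v : Maybe (Word k)) → Dec (u ≡ v)
  _≟mw_ = MaybeP.≡-dec _≟w_

  -- u ∈ Q_X : u is a strict prefix of X
  StrictPrefix : Word k → Word k → Set
  StrictPrefix u X = (length u < length X) × (u ≡ take (length u) X)

  isStrictPrefix : Word k → Word k → Bool
  isStrictPrefix u X = (length u <ᵇ length X) ∧ does (u ≟w take (length u) X)

  QX : Word k → List (Word k)
  QX X = map (λ i → take i X) (upTo (length X))

  longestSuffixInQ : Word k → Word k → Word k
  longestSuffixInQ X [] = []
  longestSuffixInQ X (a ∷ w) =
    if isStrictPrefix (a ∷ w) X then a ∷ w else longestSuffixInQ X w

  δ : Word k → Word k → Fin k → Word k
  δ X u α = longestSuffixInQ X (u ++ [ α ])

  run : Word k → Word k → Word k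
  run X w = foldl (δ X) [] w

  allWords : ℕ → List (Word k)
  allWords zero = [] ∷ []
  allWords (suc j) = concatMap (λ w → map (λ a → w ++ [ a ]) (allFin k)) (allWords j)

  borderSearch : Word k → ℕ → Word k
  borderSearch v zero = []
  borderSearch v (suc i) =
    if does (take (suc i) v ≟w drop (length v ∸ suc i) v)
    then take (suc i) v else borderSearch v i

  ∂ : Word k → Maybe (Word k)
  ∂ [] = nothing
  ∂ v@(_ ∷ _) = just (borderSearch v (length v ∸ 1))

module WithRing {c ℓ : Level} (R : CommutativeRing c ℓ) {k : ℕ} (π : Fin k → CommutativeRing.Carrier R) where
  open CommutativeRing R

  Σ : List Carrier → Carrier
  Σ = foldr _+_ 0#

  πw : Word k → Carrier
  πw w = foldr (λ a r → π a * r) 1# w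

  pX : Word k → ℕ → Word k → Carrier
  pX X j u = Σ (map (λ w → if does (run X w ≟w u) then πw w else 0#) (allWords j))

  pStat : Word k → Word k → Carrier
  pStat X u = πw u - Σ (map (λ v → if does (∂ v ≟mw just u) then πw v else 0#) (QX X))

{-# OPTIONS --safe #-}
module Submission where

-- After reading w the automaton is in state L(w), the longest suffix of w in the prefix-closed set Q_X:
-- prepending a letter gives L(xw) = xw when xw ∈ Q_X, and then ∂(xw) = L(w), and L(xw) = L(w) otherwise.
-- By induction on w this yields, for u ∈ Q_X, the pointwise identity
--   [L(w) = u] + #{v ∈ Q_X | ∂v = u, v a suffix of w} = [u is a suffix of w].
-- Weight it by π(w) and sum over the words of length j. As Σ_α π(α) = 1, the words of length j ≥ |v|
-- that end in v carry total weight π(v), so p_X(j,u) + Σ_{∂v = u} π(v) = π(u).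

open import Defs
open import Algebra.Bundles using (CommutativeRing)
open import Algebra.Definitions.RawMagma using (_,_)
open import Data.Bool using (if_then_else_)
open import Data.Fin using (Fin; zero; suc)
open import Data.Fin.Properties using (_≟_)
open import Data.List
  using (List; []; _∷_; _++_; [_]; _∷ʳ_; length; map; foldr; foldl; concatMap; take; drop; allFin; upTo; applyUpTo)
open import Data.List.Properties
  using (≡-dec; ++-assoc; ++-identityʳ; ∷-injectiveˡ; ∷-injectiveʳ; ∷ʳ-injective; length-++; length-++-≤ˡ;
         length-take; take-take; map-∘; map-tabulate; map-applyUpTo; map-upTo)
open import Data.List.Relation.Binary.Pointwise using ([]; Pointwise-≡⇒≡; ≡⇒Pointwise-≡)
open import Data.List.Relation.Binary.Suffix.Heterogeneous using (Suffix; here; there)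
open import Data.List.Relation.Binary.Suffix.Heterogeneous.Properties using (length-mono; ++⁺; suffix?)
open import Data.List.Relation.Binary.Suffix.Propositional.Properties using (Suffix-as-∣ʳ; ∣ʳ-as-Suffix)
open import Data.List.Relation.Unary.All as All using (All; []; _∷_)
open import Data.List.Relation.Unary.All.Properties using (applyUpTo⁺₁)
open import Data.List.Reverse using (reverseView; []; _∶_∶ʳ_)
open import Data.Maybe using (just)
open import Data.Nat using (ℕ; zero; suc; _≤_; _<_; _∸_; _⊓_; z≤n; s≤s; s≤s⁻¹)
open import Data.Nat.Properties
  using (_<?_; ≤-refl; ≤-reflexive; ≤-trans; <-trans; ≤-<-trans; <-irrefl; <⇒≤; m≤n⇒m⊓n≡m; m⊓n≤m; m+n∸n≡m)
open import Data.Product using (_×_; _,_; proj₁; proj₂)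
open import Data.Sum using (_⊎_; inj₁; inj₂)
open import Function.Base using (_∘_; id)
open import Function.Bundles using (_⇔_; mk⇔)
open import Level using (Level)
open import Relation.Binary.Definitions using (DecidableEquality)
open import Relation.Binary.PropositionalEquality as ≡ using (_≡_; refl; cong; subst)
open import Relation.Nullary using (Dec; yes; no; does; ¬_)
open import Relation.Nullary.Decidable using (_×-dec_; _⊎-dec_; does-⇔; dec-true; dec-false)

module _ {a} {A : Set a} where

  open ≡.≡-Reasoning

  []-suffix : (w : List A) → Suffix _≡_ [] w
  []-suffix []      = here []
  []-suffix (_ ∷ w) = there ([]-suffix w)

  suffix-[]⇔ : {v : List A} → Suffix _≡_ v [] ⇔ [] ≡ v
  suffix-[]⇔ = mk⇔ (λ { (here []) → refl }) (λ { refl → here [] })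

  suffix-∷⇔ : {v w : List A} {x : A} → Suffix _≡_ v (x ∷ w) ⇔ (v ≡ x ∷ w ⊎ Suffix _≡_ v w)
  suffix-∷⇔ = mk⇔ to from
    where
    to : ∀ {v w x} → Suffix _≡_ v (x ∷ w) → v ≡ x ∷ w ⊎ Suffix _≡_ v w
    to (here v≋xw) = inj₁ (Pointwise-≡⇒≡ v≋xw)
    to (there s)   = inj₂ s
    from : ∀ {v w x} → v ≡ x ∷ w ⊎ Suffix _≡_ v w → Suffix _≡_ v (x ∷ w)
    from (inj₁ refl) = here (≡⇒Pointwise-≡ refl)
    from (inj₂ s)    = there s

  suffix-∷-disjoint : {v w : List A} {x : A} → ¬ (v ≡ x ∷ w × Suffix _≡_ v w)
  suffix-∷-disjoint (refl , s) = <-irrefl refl (length-mono s)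

  suffix-∷ʳ⇔ : {v w : List A} {x y : A} → Suffix _≡_ (v ∷ʳ y) (w ∷ʳ x) ⇔ (Suffix _≡_ v w × x ≡ y)
  suffix-∷ʳ⇔ = mk⇔ to from
    where
    to : ∀ {v w x y} → Suffix _≡_ (v ∷ʳ y) (w ∷ʳ x) → Suffix _≡_ v w × x ≡ y
    to {v} {w} {x} {y} s with q , qvy≡wx ← Suffix-as-∣ʳ s
                         with refl , refl ← ∷ʳ-injective (q ++ v) w (≡.trans (++-assoc q v [ y ]) qvy≡wx)
      = ∣ʳ-as-Suffix (q , refl) , refl
    from : ∀ {v w x y} → Suffix _≡_ v w × x ≡ y → Suffix _≡_ (v ∷ʳ y) (w ∷ʳ x)
    from (s , refl) = ++⁺ s (≡⇒Pointwise-≡ refl)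

  length-∷ʳ : (u : List A) (x : A) → length (u ∷ʳ x) ≡ suc (length u)
  length-∷ʳ []      x = refl
  length-∷ʳ (_ ∷ u) x = cong suc (length-∷ʳ u x)

  take-++-length : (u z : List A) → take (length u) (u ++ z) ≡ u
  take-++-length []      z = refl
  take-++-length (x ∷ u) z = cong (x ∷_) (take-++-length u z)

  drop-++-length : (u z : List A) → drop (length u) (u ++ z) ≡ z
  drop-++-length []      z = refl
  drop-++-length (x ∷ u) z = drop-++-length u z

  drop-suffix : (u z : List A) → drop (length (u ++ z) ∸ length z) (u ++ z) ≡ z
  drop-suffix u z = begin
    drop (length (u ++ z) ∸ length z) (u ++ z) ≡⟨ cong (λ n → drop n (u ++ z)) |u| ⟩
    drop (length u) (u ++ z)                   ≡⟨ drop-++-length u z ⟩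
    z                                          ∎
    where
    |u| : length (u ++ z) ∸ length z ≡ length u
    |u| = ≡.trans (cong (_∸ length z) (length-++ u)) (m+n∸n≡m (length u) (length z))

  take-of-prefix : {v X : List A} {i : ℕ} → i ≤ length v → v ≡ take (length v) X → take i v ≡ take i X
  take-of-prefix {v} {X} {i} i≤|v| v≡X = begin
    take i v                   ≡⟨ cong (take i) v≡X ⟩
    take i (take (length v) X) ≡⟨ take-take i (length v) X ⟩
    take (i ⊓ length v) X      ≡⟨ cong (λ n → take n X) (m≤n⇒m⊓n≡m i≤|v|) ⟩
    take i X                   ∎

module _ {k : ℕ} where

  open ≡.≡-Reasoning

  strictPrefix? : (u X : Word k) → Dec (StrictPrefix u X)
  strictPrefix? u X = (length u <? length X) ×-dec (u ≟w take (length u) X)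

  []-strictPrefix : (x : Fin k) (X : Word k) → StrictPrefix [] (x ∷ X)
  []-strictPrefix _ _ = s≤s z≤n , refl

  ¬strictPrefix-[] : {w : Word k} → ¬ StrictPrefix w []
  ¬strictPrefix-[] ()

  strictPrefix-∷⇔ : {x : Fin k} {w X : Word k} → StrictPrefix (x ∷ w) (x ∷ X) ⇔ StrictPrefix w X
  strictPrefix-∷⇔ = mk⇔ (λ (lt , eq) → s≤s⁻¹ lt , ∷-injectiveʳ eq) (λ (lt , eq) → s≤s lt , cong (_ ∷_) eq)

  strictPrefix-∷-head : {x y : Fin k} {w X : Word k} → StrictPrefix (y ∷ w) (x ∷ X) → y ≡ x
  strictPrefix-∷-head = ∷-injectiveˡ ∘ proj₂

  QX-∷ : (x : Fin k) (X : Word k) → QX (x ∷ X) ≡ [] ∷ map (x ∷_) (QX X)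
  QX-∷ x X = cong ([] ∷_) (begin
    map (λ i → take i (x ∷ X)) (applyUpTo suc (length X)) ≡⟨ map-applyUpTo suc _ (length X) ⟩
    applyUpTo (λ i → x ∷ take i X) (length X)              ≡⟨ map-upTo _ (length X) ⟨
    map (λ i → x ∷ take i X) (upTo (length X))             ≡⟨ map-∘ (upTo (length X)) ⟩
    map (x ∷_) (QX X)                                      ∎)

  QX-length : (X : Word k) → All (λ v → length v < length X) (QX X)
  QX-length X = subst (All _) (≡.sym (map-upTo (λ i → take i X) (length X)))
                       (applyUpTo⁺₁ (λ i → take i X) (length X) (λ {i} → ≤-<-trans (|take| i)))
    where
    |take| : ∀ i → length (take i X) ≤ i
    |take| i = ≤-trans (≤-reflexive (length-take i X)) (m⊓n≤m i (length X))

  borderSearch-yes : {v : Word k} {i : ℕ} → take (suc i) v ≡ drop (length v ∸ suc i) v →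
                     borderSearch v (suc i) ≡ take (suc i) v
  borderSearch-yes {v} {i} eq = cong (λ b → if b then take (suc i) v else borderSearch v i)
                                     (dec-true (take (suc i) v ≟w drop (length v ∸ suc i) v) eq)

  borderSearch-no : {v : Word k} {i : ℕ} → ¬ take (suc i) v ≡ drop (length v ∸ suc i) v →
                    borderSearch v (suc i) ≡ borderSearch v i
  borderSearch-no {v} {i} neq = cong (λ b → if b then take (suc i) v else borderSearch v i)
                                     (dec-false (take (suc i) v ≟w drop (length v ∸ suc i) v) neq)

  module _ (X : Word k) where

    strictPrefix-++⁻ : {u z : Word k} → StrictPrefix (u ++ z) X → StrictPrefix u X
    strictPrefix-++⁻ {u} {z} (lt , eq) =
      ≤-<-trans (length-++-≤ˡ u) lt , ≡.trans (≡.sym (take-++-length u z)) (take-of-prefix (length-++-≤ˡ u) eq)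

    longestSuffixInQ-∈ : {x : Fin k} {w : Word k} → StrictPrefix (x ∷ w) X → longestSuffixInQ X (x ∷ w) ≡ x ∷ w
    longestSuffixInQ-∈ {x} {w} xw∈Q =
      cong (λ b → if b then x ∷ w else longestSuffixInQ X w) (dec-true (strictPrefix? (x ∷ w) X) xw∈Q)

    longestSuffixInQ-∉ : {x : Fin k} {w : Word k} → ¬ StrictPrefix (x ∷ w) X →
                         longestSuffixInQ X (x ∷ w) ≡ longestSuffixInQ X w
    longestSuffixInQ-∉ {x} {w} xw∉Q =
      cong (λ b → if b then x ∷ w else longestSuffixInQ X w) (dec-false (strictPrefix? (x ∷ w) X) xw∉Q)

    longestSuffixInQ-++ : (w z : Word k) →
                          longestSuffixInQ X (longestSuffixInQ X w ++ z) ≡ longestSuffixInQ X (w ++ z)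
    longestSuffixInQ-++ []      z = refl
    longestSuffixInQ-++ (x ∷ w) z with strictPrefix? (x ∷ w) X
    ... | yes xw∈Q = cong (λ s → longestSuffixInQ X (s ++ z)) (longestSuffixInQ-∈ xw∈Q)
    ... | no xw∉Q  = begin
      longestSuffixInQ X (longestSuffixInQ X (x ∷ w) ++ z)
        ≡⟨ cong (λ s → longestSuffixInQ X (s ++ z)) (longestSuffixInQ-∉ xw∉Q) ⟩
      longestSuffixInQ X (longestSuffixInQ X w ++ z)
        ≡⟨ longestSuffixInQ-++ w z ⟩
      longestSuffixInQ X (w ++ z)
        ≡⟨ longestSuffixInQ-∉ (xw∉Q ∘ strictPrefix-++⁻) ⟨
      longestSuffixInQ X (x ∷ w ++ z)
        ∎

    foldl-δ : (r w : Word k) → foldl (δ X) (longestSuffixInQ X r) w ≡ longestSuffixInQ X (r ++ w)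
    foldl-δ r []      = cong (longestSuffixInQ X) (≡.sym (++-identityʳ r))
    foldl-δ r (x ∷ w) = begin
      foldl (δ X) (longestSuffixInQ X (longestSuffixInQ X r ++ [ x ])) w
        ≡⟨ cong (λ s → foldl (δ X) s w) (longestSuffixInQ-++ r [ x ]) ⟩
      foldl (δ X) (longestSuffixInQ X (r ++ [ x ])) w
        ≡⟨ foldl-δ (r ++ [ x ]) w ⟩
      longestSuffixInQ X ((r ++ [ x ]) ++ w)
        ≡⟨ cong (longestSuffixInQ X) (++-assoc r [ x ] w) ⟩
      longestSuffixInQ X (r ++ x ∷ w)
        ∎

    run≡longestSuffixInQ : (w : Word k) → run X w ≡ longestSuffixInQ X w
    run≡longestSuffixInQ = foldl-δ []

    -- For v ∈ Q_X, a suffix s of v is a border of v exactly when s ∈ Q_X, so the search for the longest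
    -- border of length ≤ |s| is the search for the longest suffix of s in Q_X.
    borderSearch-suffix : (q s : Word k) {v : Word k} → q ++ s ≡ v → StrictPrefix v X → length s < length v →
                          borderSearch v (length s) ≡ longestSuffixInQ X s
    borderSearch-suffix q []      _    _   _   = refl
    borderSearch-suffix q (x ∷ s) refl v∈Q s<v with strictPrefix? (x ∷ s) X
    ... | yes xs∈Q = begin
      borderSearch (q ++ x ∷ s) (length (x ∷ s))
        ≡⟨ borderSearch-yes (≡.trans take-v (≡.trans (≡.sym (proj₂ xs∈Q)) (≡.sym drop-v))) ⟩
      take (length (x ∷ s)) (q ++ x ∷ s)
        ≡⟨ take-v ⟩
      take (length (x ∷ s)) X
        ≡⟨ proj₂ xs∈Q ⟨
      x ∷ s
        ≡⟨ longestSuffixInQ-∈ xs∈Q ⟨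
      longestSuffixInQ X (x ∷ s)
        ∎
      where
      take-v = take-of-prefix (<⇒≤ s<v) (proj₂ v∈Q)
      drop-v = drop-suffix q (x ∷ s)
    ... | no xs∉Q = begin
      borderSearch (q ++ x ∷ s) (length (x ∷ s))
        ≡⟨ borderSearch-no (xs∉Q ∘ border⇒∈Q) ⟩
      borderSearch (q ++ x ∷ s) (length s)
        ≡⟨ borderSearch-suffix (q ∷ʳ x) s (++-assoc q [ x ] s) v∈Q (<-trans (s≤s ≤-refl) s<v) ⟩
      longestSuffixInQ X s
        ≡⟨ longestSuffixInQ-∉ xs∉Q ⟨
      longestSuffixInQ X (x ∷ s)
        ∎
      where
      take-v = take-of-prefix (<⇒≤ s<v) (proj₂ v∈Q)
      drop-v = drop-suffix q (x ∷ s)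
      border⇒∈Q : take (length (x ∷ s)) (q ++ x ∷ s) ≡ drop (length (q ++ x ∷ s) ∸ length (x ∷ s)) (q ++ x ∷ s) →
                  StrictPrefix (x ∷ s) X
      border⇒∈Q eq = <-trans s<v (proj₁ v∈Q) , ≡.trans (≡.sym drop-v) (≡.trans (≡.sym eq) take-v)

    ∂-∷ : {x : Fin k} {w : Word k} → StrictPrefix (x ∷ w) X → ∂ (x ∷ w) ≡ just (longestSuffixInQ X w)
    ∂-∷ {x} {w} xw∈Q = cong just (borderSearch-suffix [ x ] w refl xw∈Q ≤-refl)

module IndicatorSums {c ℓ} (R : CommutativeRing c ℓ) where

  open CommutativeRing R hiding (zero) renaming (refl to ≈-refl)
  open import Relation.Binary.Reasoning.Setoid setoid
  open import Algebra.Properties.CommutativeSemigroup +-commutativeSemigroup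
    using () renaming (interchange to +-interchange)

  private variable
    p q : Level
    P : Set p
    Q : Set q

  -- Through does, 𝟙 computes under Dec.map′ and _×-dec_: e.g. 𝟙 (just v ≟mw just u) reduces to 𝟙 (v ≟w u).
  𝟙 : Dec P → Carrier
  𝟙 P? = if does P? then 1# else 0#

  if-does≈𝟙* : (P? : Dec P) (x : Carrier) → (if does P? then x else 0#) ≈ 𝟙 P? * x
  if-does≈𝟙* (yes _) x = sym (*-identityˡ x)
  if-does≈𝟙* (no _)  x = sym (zeroˡ x)

  𝟙-⇔ : P ⇔ Q → (P? : Dec P) (Q? : Dec Q) → 𝟙 P? ≡ 𝟙 Q?
  𝟙-⇔ P⇔Q P? Q? = cong (λ b → if b then 1# else 0#) (does-⇔ P⇔Q P? Q?)

  𝟙-yes : (P? : Dec P) → P → 𝟙 P? ≡ 1#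
  𝟙-yes P? p = cong (λ b → if b then 1# else 0#) (dec-true P? p)

  𝟙-no : (P? : Dec P) → ¬ P → 𝟙 P? ≡ 0#
  𝟙-no P? ¬p = cong (λ b → if b then 1# else 0#) (dec-false P? ¬p)

  𝟙-yes-* : (P? : Dec P) → P → (x : Carrier) → 𝟙 P? * x ≈ x
  𝟙-yes-* P? p x = trans (*-congʳ (reflexive (𝟙-yes P? p))) (*-identityˡ x)

  𝟙-no-* : (P? : Dec P) → ¬ P → (x : Carrier) → 𝟙 P? * x ≈ 0#
  𝟙-no-* P? ¬p x = trans (*-congʳ (reflexive (𝟙-no P? ¬p))) (zeroˡ x)

  𝟙-× : (P? : Dec P) (Q? : Dec Q) → 𝟙 (P? ×-dec Q?) ≈ 𝟙 P? * 𝟙 Q?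
  𝟙-× (yes _) Q? = sym (*-identityˡ (𝟙 Q?))
  𝟙-× (no _)  Q? = sym (zeroˡ (𝟙 Q?))

  𝟙-⊎ : ¬ (P × Q) → (P? : Dec P) (Q? : Dec Q) → 𝟙 (P? ⊎-dec Q?) ≈ 𝟙 P? + 𝟙 Q?
  𝟙-⊎ ¬p×q (yes p) (yes q) with () ← ¬p×q (p , q)
  𝟙-⊎ ¬p×q (yes _) (no _)  = sym (+-identityʳ 1#)
  𝟙-⊎ ¬p×q (no _)  Q?      = sym (+-identityˡ (𝟙 Q?))

  module _ {a} {A : Set a} where

    ∑ : (A → Carrier) → List A → Carrier
    ∑ f xs = foldr _+_ 0# (map f xs)

    syntax ∑ (λ x → e) xs = ∑[ x ← xs ] e

    ∑-cong : {f g : A → Carrier} → (∀ x → f x ≈ g x) → ∀ xs → ∑ f xs ≈ ∑ g xs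
    ∑-cong f≈g []       = ≈-refl
    ∑-cong f≈g (x ∷ xs) = +-cong (f≈g x) (∑-cong f≈g xs)

    ∑-congᴬ : {f g : A → Carrier} {xs : List A} → All (λ x → f x ≈ g x) xs → ∑ f xs ≈ ∑ g xs
    ∑-congᴬ []             = ≈-refl
    ∑-congᴬ (fx≈gx ∷ f≈g) = +-cong fx≈gx (∑-congᴬ f≈g)

    ∑-zero : {f : A → Carrier} → (∀ x → f x ≈ 0#) → ∀ xs → ∑ f xs ≈ 0#
    ∑-zero f≈0 []       = ≈-refl
    ∑-zero f≈0 (x ∷ xs) = trans (+-cong (f≈0 x) (∑-zero f≈0 xs)) (+-identityˡ 0#)

    ∑-+ : (f g : A → Carrier) → ∀ xs → ∑[ x ← xs ] (f x + g x) ≈ ∑ f xs + ∑ g xs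
    ∑-+ f g []       = sym (+-identityˡ 0#)
    ∑-+ f g (x ∷ xs) = trans (+-congˡ (∑-+ f g xs)) (+-interchange (f x) (g x) (∑ f xs) (∑ g xs))

    ∑-*ˡ : (y : Carrier) (f : A → Carrier) → ∀ xs → ∑[ x ← xs ] (y * f x) ≈ y * ∑ f xs
    ∑-*ˡ y f []       = sym (zeroʳ y)
    ∑-*ˡ y f (x ∷ xs) = trans (+-congˡ (∑-*ˡ y f xs)) (sym (distribˡ y (f x) (∑ f xs)))

    ∑-*ʳ : (y : Carrier) (f : A → Carrier) → ∀ xs → ∑[ x ← xs ] (f x * y) ≈ ∑ f xs * y
    ∑-*ʳ y f xs = begin
      ∑[ x ← xs ] (f x * y) ≈⟨ ∑-cong (λ x → *-comm (f x) y) xs ⟩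
      ∑[ x ← xs ] (y * f x) ≈⟨ ∑-*ˡ y f xs ⟩
      y * ∑ f xs            ≈⟨ *-comm y (∑ f xs) ⟩
      ∑ f xs * y            ∎

    ∑-++ : (f : A → Carrier) → ∀ xs ys → ∑ f (xs ++ ys) ≈ ∑ f xs + ∑ f ys
    ∑-++ f []       ys = sym (+-identityˡ (∑ f ys))
    ∑-++ f (x ∷ xs) ys = trans (+-congˡ (∑-++ f xs ys)) (sym (+-assoc (f x) (∑ f xs) (∑ f ys)))

  module _ {a b} {A : Set a} {B : Set b} where

    ∑-map : (f : B → Carrier) (g : A → B) → ∀ xs → ∑ f (map g xs) ≡ ∑ (f ∘ g) xs
    ∑-map f g xs = cong (foldr _+_ 0#) (≡.sym (map-∘ xs))

    ∑-concatMap : (f : B → Carrier) (g : A → List B) → ∀ xs → ∑ f (concatMap g xs) ≈ ∑[ x ← xs ] ∑ f (g x)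
    ∑-concatMap f g []       = ≈-refl
    ∑-concatMap f g (x ∷ xs) = trans (∑-++ f (g x) (concatMap g xs)) (+-congˡ (∑-concatMap f g xs))

    ∑-comm : (h : A → B → Carrier) → ∀ xs ys → ∑[ x ← xs ] ∑[ y ← ys ] h x y ≈ ∑[ y ← ys ] ∑[ x ← xs ] h x y
    ∑-comm h []       ys = sym (∑-zero (λ _ → ≈-refl) ys)
    ∑-comm h (x ∷ xs) ys = trans (+-congˡ (∑-comm h xs ys)) (sym (∑-+ (h x) (λ y → ∑[ x ← xs ] h x y) ys))

  ∑-allFin-suc : ∀ {n} (f : Fin (suc n) → Carrier) → ∑ f (allFin (suc n)) ≡ f zero + ∑ (f ∘ suc) (allFin n)
  ∑-allFin-suc {n} f = cong (f zero +_) (≡.trans (cong (∑ f) (≡.sym (map-tabulate id suc))) (∑-map f suc (allFin n)))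

  ∑-allFin-select : ∀ {n} (f : Fin n → Carrier) (j : Fin n) → ∑[ i ← allFin n ] (𝟙 (i ≟ j) * f i) ≈ f j
  ∑-allFin-select {suc n} f zero = begin
    ∑[ i ← allFin (suc n) ] (𝟙 (i ≟ zero) * f i)
      ≡⟨ ∑-allFin-suc (λ i → 𝟙 (i ≟ zero) * f i) ⟩
    1# * f zero + ∑[ i ← allFin n ] (0# * f (suc i))
      ≈⟨ +-cong (*-identityˡ (f zero)) (∑-zero (λ i → zeroˡ (f (suc i))) (allFin n)) ⟩
    f zero + 0#
      ≈⟨ +-identityʳ (f zero) ⟩
    f zero
      ∎
  ∑-allFin-select {suc n} f (suc j) = begin
    ∑[ i ← allFin (suc n) ] (𝟙 (i ≟ suc j) * f i)
      ≡⟨ ∑-allFin-suc (λ i → 𝟙 (i ≟ suc j) * f i) ⟩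
    0# * f zero + ∑[ i ← allFin n ] (𝟙 (i ≟ j) * f (suc i))
      ≈⟨ +-cong (zeroˡ (f zero)) (∑-allFin-select (f ∘ suc) j) ⟩
    0# + f (suc j)
      ≈⟨ +-identityˡ (f (suc j)) ⟩
    f (suc j)
      ∎

  module _ {a} {A : Set a} (_≟ᴬ_ : DecidableEquality A) where

    𝟙-suffix-∷ : (v w : List A) (x : A) →
                 𝟙 (suffix? _≟ᴬ_ v (x ∷ w)) ≈ 𝟙 (≡-dec _≟ᴬ_ v (x ∷ w)) + 𝟙 (suffix? _≟ᴬ_ v w)
    𝟙-suffix-∷ v w x = begin
      𝟙 (suffix? _≟ᴬ_ v (x ∷ w)) ≡⟨ 𝟙-⇔ suffix-∷⇔ (suffix? _≟ᴬ_ v (x ∷ w)) (v≡xw? ⊎-dec v⊒w?) ⟩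
      𝟙 (v≡xw? ⊎-dec v⊒w?)       ≈⟨ 𝟙-⊎ suffix-∷-disjoint v≡xw? v⊒w? ⟩
      𝟙 v≡xw? + 𝟙 v⊒w?           ∎
      where
      v≡xw? = ≡-dec _≟ᴬ_ v (x ∷ w)
      v⊒w?  = suffix? _≟ᴬ_ v w

    𝟙-suffix-∷ʳ : (v w : List A) (x y : A) →
                  𝟙 (suffix? _≟ᴬ_ (v ∷ʳ y) (w ∷ʳ x)) ≈ 𝟙 (suffix? _≟ᴬ_ v w) * 𝟙 (x ≟ᴬ y)
    𝟙-suffix-∷ʳ v w x y = begin
      𝟙 (suffix? _≟ᴬ_ (v ∷ʳ y) (w ∷ʳ x)) ≡⟨ 𝟙-⇔ suffix-∷ʳ⇔ (suffix? _≟ᴬ_ (v ∷ʳ y) (w ∷ʳ x)) (v⊒w? ×-dec x≡y?) ⟩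
      𝟙 (v⊒w? ×-dec x≡y?)                ≈⟨ 𝟙-× v⊒w? x≡y? ⟩
      𝟙 v⊒w? * 𝟙 x≡y?                    ∎
      where
      v⊒w? = suffix? _≟ᴬ_ v w
      x≡y? = x ≟ᴬ y

module Occupation {c ℓ} (R : CommutativeRing c ℓ) {k : ℕ} where

  open CommutativeRing R hiding (zero)
  open IndicatorSums R
  open import Relation.Binary.Reasoning.Setoid setoid
  open import Algebra.Properties.CommutativeSemigroup *-commutativeSemigroup
    using (xy∙z≈y∙xz) renaming (interchange to *-interchange)

  ∑-QX-∷ : (g : Word k → Carrier) (x : Fin k) (X : Word k) → ∑ g (QX (x ∷ X)) ≡ g [] + ∑[ v ← QX X ] g (x ∷ v)
  ∑-QX-∷ g x X = ≡.trans (cong (∑ g) (QX-∷ x X)) (cong (g [] +_) (∑-map g (x ∷_) (QX X)))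

  ∑-QX-select : (X w : Word k) (f : Word k → Carrier) →
                ∑[ v ← QX X ] (𝟙 (v ≟w w) * f v) ≈ 𝟙 (strictPrefix? w X) * f w
  ∑-QX-select [] w f = sym (𝟙-no-* (strictPrefix? w []) ¬strictPrefix-[] (f w))
  ∑-QX-select (x ∷ X) [] f = begin
    ∑[ v ← QX (x ∷ X) ] (𝟙 (v ≟w []) * f v)    ≡⟨ ∑-QX-∷ (λ v → 𝟙 (v ≟w []) * f v) x X ⟩
    1# * f [] + ∑[ v ← QX X ] (0# * f (x ∷ v)) ≈⟨ +-congˡ (∑-zero (λ v → zeroˡ (f (x ∷ v))) (QX X)) ⟩
    1# * f [] + 0#                             ≈⟨ +-identityʳ (1# * f []) ⟩
    1# * f []                                  ≡⟨ cong (_* f []) (𝟙-yes (strictPrefix? [] (x ∷ X)) ([]-strictPrefix x X)) ⟨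
    𝟙 (strictPrefix? [] (x ∷ X)) * f []        ∎
  -- Split on x ≟ y rather than y ≟ x: the latter occurs in the goal and would be abstracted by with.
  ∑-QX-select (x ∷ X) (y ∷ w) f with x ≟ y
  ... | yes refl = begin
    ∑[ v ← QX (x ∷ X) ] (𝟙 (v ≟w (x ∷ w)) * f v)
      ≡⟨ ∑-QX-∷ (λ v → 𝟙 (v ≟w (x ∷ w)) * f v) x X ⟩
    0# * f [] + ∑[ v ← QX X ] (𝟙 ((x ∷ v) ≟w (x ∷ w)) * f (x ∷ v))
      ≈⟨ +-cong (zeroˡ (f [])) (∑-cong (λ v → *-congʳ (reflexive (𝟙-⇔ ∷⇔ ((x ∷ v) ≟w (x ∷ w)) (v ≟w w))))
                                        (QX X)) ⟩
    0# + ∑[ v ← QX X ] (𝟙 (v ≟w w) * f (x ∷ v))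
      ≈⟨ +-identityˡ _ ⟩
    ∑[ v ← QX X ] (𝟙 (v ≟w w) * f (x ∷ v))
      ≈⟨ ∑-QX-select X w (f ∘ (x ∷_)) ⟩
    𝟙 (strictPrefix? w X) * f (x ∷ w)
      ≡⟨ cong (_* f (x ∷ w)) (𝟙-⇔ strictPrefix-∷⇔ (strictPrefix? (x ∷ w) (x ∷ X)) (strictPrefix? w X)) ⟨
    𝟙 (strictPrefix? (x ∷ w) (x ∷ X)) * f (x ∷ w)
      ∎
    where
    ∷⇔ : {v : Word k} → x ∷ v ≡ x ∷ w ⇔ v ≡ w
    ∷⇔ = mk⇔ ∷-injectiveʳ (cong (x ∷_))
  ... | no x≢y = begin
    ∑[ v ← QX (x ∷ X) ] (𝟙 (v ≟w (y ∷ w)) * f v)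
      ≡⟨ ∑-QX-∷ (λ v → 𝟙 (v ≟w (y ∷ w)) * f v) x X ⟩
    0# * f [] + ∑[ v ← QX X ] (𝟙 ((x ∷ v) ≟w (y ∷ w)) * f (x ∷ v))
      ≈⟨ +-cong (zeroˡ (f [])) (∑-zero (λ v → 𝟙-no-* ((x ∷ v) ≟w (y ∷ w)) (x≢y ∘ ∷-injectiveˡ) (f (x ∷ v)))
                                        (QX X)) ⟩
    0# + 0#
      ≈⟨ +-identityʳ 0# ⟩
    0#
      ≈⟨ 𝟙-no-* (strictPrefix? (y ∷ w) (x ∷ X)) (x≢y ∘ ≡.sym ∘ strictPrefix-∷-head) (f (y ∷ w)) ⟨
    𝟙 (strictPrefix? (y ∷ w) (x ∷ X)) * f (y ∷ w)
      ∎

  module _ (X u : Word k) where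

    isChild : Word k → Carrier
    isChild v = 𝟙 (∂ v ≟mw just u)

    children : Word k → Carrier
    children w = ∑[ v ← QX X ] (𝟙 (suffix? _≟_ v w) * isChild v)

    children-[] : children [] ≈ 0#
    children-[] = ∑-zero term (QX X)
      where
      term : ∀ v → 𝟙 (suffix? _≟_ v []) * isChild v ≈ 0#
      term []      = zeroʳ (𝟙 (suffix? (_≟_ {k}) [] []))
      term (x ∷ v) = 𝟙-no-* (suffix? _≟_ (x ∷ v) []) (λ { (here ()) }) (isChild (x ∷ v))

    children-∷ : (x : Fin k) (w : Word k) →
                 children (x ∷ w) ≈ 𝟙 (strictPrefix? (x ∷ w) X) * isChild (x ∷ w) + children w
    children-∷ x w = begin
      children (x ∷ w)
        ≈⟨ ∑-cong (λ v → trans (*-congʳ (𝟙-suffix-∷ _≟_ v w x)) (distribʳ (isChild v) _ _)) (QX X) ⟩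
      ∑[ v ← QX X ] (𝟙 (v ≟w (x ∷ w)) * isChild v + 𝟙 (suffix? _≟_ v w) * isChild v)
        ≈⟨ ∑-+ (λ v → 𝟙 (v ≟w (x ∷ w)) * isChild v) (λ v → 𝟙 (suffix? _≟_ v w) * isChild v) (QX X) ⟩
      ∑[ v ← QX X ] (𝟙 (v ≟w (x ∷ w)) * isChild v) + children w
        ≈⟨ +-congʳ (∑-QX-select X (x ∷ w) isChild) ⟩
      𝟙 (strictPrefix? (x ∷ w) X) * isChild (x ∷ w) + children w
        ∎

    state+children≈suffix : StrictPrefix u X → ∀ w →
                            𝟙 (longestSuffixInQ X w ≟w u) + children w ≈ 𝟙 (suffix? _≟_ u w)
    state+children≈suffix u∈Q [] = begin
      𝟙 ([] ≟w u) + children [] ≈⟨ +-congˡ children-[] ⟩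
      𝟙 ([] ≟w u) + 0#          ≈⟨ +-identityʳ (𝟙 ([] ≟w u)) ⟩
      𝟙 ([] ≟w u)               ≡⟨ 𝟙-⇔ suffix-[]⇔ (suffix? _≟_ u []) ([] ≟w u) ⟨
      𝟙 (suffix? _≟_ u [])      ∎
    state+children≈suffix u∈Q (x ∷ w) with strictPrefix? (x ∷ w) X
    ... | yes xw∈Q = begin
      𝟙 (longestSuffixInQ X (x ∷ w) ≟w u) + children (x ∷ w)
        ≈⟨ +-cong (reflexive (cong (λ s → 𝟙 (s ≟w u)) (longestSuffixInQ-∈ X xw∈Q))) (children-∷ x w) ⟩
      𝟙 ((x ∷ w) ≟w u) + (𝟙 (strictPrefix? (x ∷ w) X) * isChild (x ∷ w) + children w)
        ≈⟨ +-congˡ (+-congʳ (𝟙-yes-* (strictPrefix? (x ∷ w) X) xw∈Q (isChild (x ∷ w)))) ⟩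
      𝟙 ((x ∷ w) ≟w u) + (isChild (x ∷ w) + children w)
        ≡⟨ cong (λ d → 𝟙 ((x ∷ w) ≟w u) + (𝟙 (d ≟mw just u) + children w)) (∂-∷ X xw∈Q) ⟩
      𝟙 ((x ∷ w) ≟w u) + (𝟙 (longestSuffixInQ X w ≟w u) + children w)
        ≈⟨ +-congˡ (state+children≈suffix u∈Q w) ⟩
      𝟙 ((x ∷ w) ≟w u) + 𝟙 (suffix? _≟_ u w)
        ≡⟨ cong (_+ 𝟙 (suffix? _≟_ u w)) (𝟙-⇔ (mk⇔ ≡.sym ≡.sym) ((x ∷ w) ≟w u) (u ≟w (x ∷ w))) ⟩
      𝟙 (u ≟w (x ∷ w)) + 𝟙 (suffix? _≟_ u w)
        ≈⟨ 𝟙-suffix-∷ _≟_ u w x ⟨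
      𝟙 (suffix? _≟_ u (x ∷ w))
        ∎
    ... | no xw∉Q = begin
      𝟙 (longestSuffixInQ X (x ∷ w) ≟w u) + children (x ∷ w)
        ≈⟨ +-cong (reflexive (cong (λ s → 𝟙 (s ≟w u)) (longestSuffixInQ-∉ X xw∉Q))) (children-∷ x w) ⟩
      𝟙 (longestSuffixInQ X w ≟w u) + (𝟙 (strictPrefix? (x ∷ w) X) * isChild (x ∷ w) + children w)
        ≈⟨ +-congˡ (trans (+-congʳ (𝟙-no-* (strictPrefix? (x ∷ w) X) xw∉Q (isChild (x ∷ w))))
                          (+-identityˡ (children w))) ⟩
      𝟙 (longestSuffixInQ X w ≟w u) + children w
        ≈⟨ state+children≈suffix u∈Q w ⟩
      𝟙 (suffix? _≟_ u w)
        ≈⟨ +-identityˡ (𝟙 (suffix? _≟_ u w)) ⟨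
      0# + 𝟙 (suffix? _≟_ u w)
        ≡⟨ cong (_+ 𝟙 (suffix? _≟_ u w)) (𝟙-no (u ≟w (x ∷ w)) (λ { refl → xw∉Q u∈Q })) ⟨
      𝟙 (u ≟w (x ∷ w)) + 𝟙 (suffix? _≟_ u w)
        ≈⟨ 𝟙-suffix-∷ _≟_ u w x ⟨
      𝟙 (suffix? _≟_ u (x ∷ w))
        ∎

  ∑-allWords-suc : (g : Word k → Carrier) (j : ℕ) →
                   ∑ g (allWords (suc j)) ≈ ∑[ w ← allWords j ] ∑[ x ← allFin k ] g (w ∷ʳ x)
  ∑-allWords-suc g j =
    trans (∑-concatMap g _ (allWords j)) (∑-cong (λ w → reflexive (∑-map g (w ∷ʳ_) (allFin k))) (allWords j))

  module _ (π : Fin k → Carrier) where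

    open WithRing R π using (πw)

    πw-∷ʳ : (w : Word k) (x : Fin k) → πw (w ∷ʳ x) ≈ πw w * π x
    πw-∷ʳ []      x = trans (*-identityʳ (π x)) (sym (*-identityˡ (π x)))
    πw-∷ʳ (y ∷ w) x = trans (*-congˡ (πw-∷ʳ w x)) (sym (*-assoc (π y) (πw w) (π x)))

    suffixMass : ℕ → Word k → Carrier
    suffixMass j v = ∑[ w ← allWords j ] (𝟙 (suffix? _≟_ v w) * πw w)

    suffixMass-suc : (v v′ : Word k) (c : Fin k → Carrier) →
                     (∀ w x → 𝟙 (suffix? _≟_ v (w ∷ʳ x)) ≈ 𝟙 (suffix? _≟_ v′ w) * c x) →
                     ∀ j → suffixMass (suc j) v ≈ suffixMass j v′ * ∑[ x ← allFin k ] (c x * π x)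
    suffixMass-suc v v′ c split j = begin
      suffixMass (suc j) v
        ≈⟨ ∑-allWords-suc (λ w → 𝟙 (suffix? _≟_ v w) * πw w) j ⟩
      ∑[ w ← allWords j ] ∑[ x ← allFin k ] (𝟙 (suffix? _≟_ v (w ∷ʳ x)) * πw (w ∷ʳ x))
        ≈⟨ ∑-cong (λ w → ∑-cong (λ x → trans (*-cong (split w x) (πw-∷ʳ w x)) (*-interchange _ _ _ _)) (allFin k))
                  (allWords j) ⟩
      ∑[ w ← allWords j ] ∑[ x ← allFin k ] ((𝟙 (suffix? _≟_ v′ w) * πw w) * (c x * π x))
        ≈⟨ ∑-cong (λ w → ∑-*ˡ _ (λ x → c x * π x) (allFin k)) (allWords j) ⟩
      ∑[ w ← allWords j ] ((𝟙 (suffix? _≟_ v′ w) * πw w) * ∑[ x ← allFin k ] (c x * π x))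
        ≈⟨ ∑-*ʳ _ (λ w → 𝟙 (suffix? _≟_ v′ w) * πw w) (allWords j) ⟩
      suffixMass j v′ * ∑[ x ← allFin k ] (c x * π x)
        ∎

    suffixMass≈πw : ∑ π (allFin k) ≈ 1# → ∀ j (v : Word k) → length v ≤ j → suffixMass j v ≈ πw v
    suffixMass≈πw ∑π≈1 zero    []      _ =
      trans (+-identityʳ (𝟙 (suffix? (_≟_ {k}) [] []) * 1#)) (𝟙-yes-* (suffix? (_≟_ {k}) [] []) ([]-suffix []) 1#)
    suffixMass≈πw ∑π≈1 (suc j) v |v|≤1+j with reverseView v
    ... | [] = begin
      suffixMass (suc j) []                          ≈⟨ suffixMass-suc [] [] (λ _ → 1#) split j ⟩
      suffixMass j [] * ∑[ x ← allFin k ] (1# * π x) ≈⟨ *-cong (suffixMass≈πw ∑π≈1 j [] z≤n) ∑1π≈1 ⟩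
      1# * 1#                                        ≈⟨ *-identityˡ 1# ⟩
      1#                                             ∎
      where
      split : ∀ w x → 𝟙 (suffix? _≟_ [] (w ∷ʳ x)) ≈ 𝟙 (suffix? _≟_ [] w) * 1#
      split w x = begin
        𝟙 (suffix? _≟_ [] (w ∷ʳ x)) ≡⟨ 𝟙-yes (suffix? _≟_ [] (w ∷ʳ x)) ([]-suffix (w ∷ʳ x)) ⟩
        1#                          ≈⟨ *-identityʳ 1# ⟨
        1# * 1#                     ≡⟨ cong (_* 1#) (𝟙-yes (suffix? _≟_ [] w) ([]-suffix w)) ⟨
        𝟙 (suffix? _≟_ [] w) * 1#   ∎
      ∑1π≈1 : ∑[ x ← allFin k ] (1# * π x) ≈ 1#
      ∑1π≈1 = trans (∑-cong (λ x → *-identityˡ (π x)) (allFin k)) ∑π≈1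
    ... | v′ ∶ _ ∶ʳ y = begin
      suffixMass (suc j) (v′ ∷ʳ y)
        ≈⟨ suffixMass-suc (v′ ∷ʳ y) v′ (λ x → 𝟙 (x ≟ y)) (λ w x → 𝟙-suffix-∷ʳ _≟_ v′ w x y) j ⟩
      suffixMass j v′ * ∑[ x ← allFin k ] (𝟙 (x ≟ y) * π x)
        ≈⟨ *-cong (suffixMass≈πw ∑π≈1 j v′ |v′|≤j) (∑-allFin-select π y) ⟩
      πw v′ * π y
        ≈⟨ πw-∷ʳ v′ y ⟨
      πw (v′ ∷ʳ y)
        ∎
      where
      |v′|≤j : length v′ ≤ j
      |v′|≤j = s≤s⁻¹ (subst (_≤ suc j) (length-∷ʳ v′ y) |v|≤1+j)

    ∑-children : ∑ π (allFin k) ≈ 1# → (X u : Word k) (j : ℕ) → length X ≤ j →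
                 ∑[ w ← allWords j ] (children X u w * πw w) ≈ ∑[ v ← QX X ] (isChild X u v * πw v)
    ∑-children ∑π≈1 X u j |X|≤j = begin
      ∑[ w ← allWords j ] (children X u w * πw w)
        ≈⟨ ∑-cong (λ w → sym (∑-*ʳ (πw w) (λ v → 𝟙 (suffix? _≟_ v w) * isChild X u v) (QX X))) (allWords j) ⟩
      ∑[ w ← allWords j ] ∑[ v ← QX X ] ((𝟙 (suffix? _≟_ v w) * isChild X u v) * πw w)
        ≈⟨ ∑-comm (λ w v → (𝟙 (suffix? _≟_ v w) * isChild X u v) * πw w) (allWords j) (QX X) ⟩
      ∑[ v ← QX X ] ∑[ w ← allWords j ] ((𝟙 (suffix? _≟_ v w) * isChild X u v) * πw w)
        ≈⟨ ∑-cong (λ v → trans (∑-cong (λ w → xy∙z≈y∙xz (𝟙 (suffix? _≟_ v w)) (isChild X u v) (πw w)) (allWords j))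
                               (∑-*ˡ (isChild X u v) (λ w → 𝟙 (suffix? _≟_ v w) * πw w) (allWords j)))
                  (QX X) ⟩
      ∑[ v ← QX X ] (isChild X u v * suffixMass j v)
        ≈⟨ ∑-congᴬ (All.map (λ {v} |v|<|X| → *-congˡ (suffixMass≈πw ∑π≈1 j v (≤-trans (<⇒≤ |v|<|X|) |X|≤j)))
                            (QX-length X)) ⟩
      ∑[ v ← QX X ] (isChild X u v * πw v)
        ∎

    ∑-state+∑-children≈πw : ∑ π (allFin k) ≈ 1# → (X u : Word k) → StrictPrefix u X → (j : ℕ) → length X ≤ j →
                            ∑[ w ← allWords j ] (𝟙 (longestSuffixInQ X w ≟w u) * πw w)
                              + ∑[ w ← allWords j ] (children X u w * πw w) ≈ πw u
    ∑-state+∑-children≈πw ∑π≈1 X u u∈Q j |X|≤j = begin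
      ∑[ w ← allWords j ] (𝟙 (longestSuffixInQ X w ≟w u) * πw w) + ∑[ w ← allWords j ] (children X u w * πw w)
        ≈⟨ ∑-+ (λ w → 𝟙 (longestSuffixInQ X w ≟w u) * πw w) (λ w → children X u w * πw w) (allWords j) ⟨
      ∑[ w ← allWords j ] (𝟙 (longestSuffixInQ X w ≟w u) * πw w + children X u w * πw w)
        ≈⟨ ∑-cong (λ w → trans (sym (distribʳ (πw w) _ _)) (*-congʳ (state+children≈suffix X u u∈Q w))) (allWords j) ⟩
      suffixMass j u
        ≈⟨ suffixMass≈πw ∑π≈1 j u (≤-trans (<⇒≤ (proj₁ u∈Q)) |X|≤j) ⟩
      πw u
        ∎

lemma2 : ∀ {c ℓ} (R : CommutativeRing c ℓ) (k : ℕ) (π : Fin k → CommutativeRing.Carrier R)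
           → CommutativeRing._≈_ R (foldr (CommutativeRing._+_ R) (CommutativeRing.0# R) (map π (allFin k))) (CommutativeRing.1# R)
           → (X u : Word k) → StrictPrefix u X
           → (j : ℕ) → length X ≤ j
           → CommutativeRing._≈_ R (WithRing.pX R π X j u) (WithRing.pStat R π X u)
lemma2 R k π ∑π≈1 X u u∈Q j |X|≤j = begin
  pX X j u
    ≈⟨ ∑-cong (λ w → trans (if-does≈𝟙* (run X w ≟w u) (πw w))
                           (reflexive (cong (λ s → 𝟙 (s ≟w u) * πw w) (run≡longestSuffixInQ X w)))) (allWords j) ⟩
  ∑[ w ← allWords j ] (𝟙 (longestSuffixInQ X w ≟w u) * πw w)
    ≈⟨ trans (sym (//-rightDividesʳ _ _)) (+-congʳ (∑-state+∑-children≈πw π ∑π≈1 X u u∈Q j |X|≤j)) ⟩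
  πw u - ∑[ w ← allWords j ] (children X u w * πw w)
    ≈⟨ +-congˡ (-‿cong (∑-children π ∑π≈1 X u j |X|≤j)) ⟩
  πw u - ∑[ v ← QX X ] (isChild X u v * πw v)
    ≈⟨ +-congˡ (-‿cong (∑-cong (λ v → sym (if-does≈𝟙* (∂ v ≟mw just u) (πw v))) (QX X))) ⟩
  pStat X u
    ∎
  where
  open CommutativeRing R
  open IndicatorSums R
  open Occupation R
  open WithRing R π using (πw; pX; pStat)
  open import Relation.Binary.Reasoning.Setoid setoid
  open import Algebra.Properties.AbelianGroup +-abelianGroup using (//-rightDividesʳ)
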